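{- Let $H$ be a finite abelian group of exponent $2$, let $\mathcal{A}=(A_h)_{h\in H}$ be a family on $H$, and let $\gamma$ be a non-trivial character of $H$. Then there is a subgroup $H' \le H$ of index $2$ and a family $\mathcal{A}'$ on $H'$ such that \[ \Lambda(\mathcal{A}) \ge 2^{ -4}\Lambda(\mathcal{A}') \quad\text{and}\quad \mathbb{P}_{H'}(\mathcal{A}') \ge \mathbb{P}_H(\mathcal{A}) + \mathbb{E}_{h\in H}|\widehat{1_{A_h}}(\gamma)|. \]
   Context: For a finite abelian group $H$ of exponent $2$: $\mathbb{E}_{x\in X}$ denotes $\frac1{|X|}\sum_{x\in X}$, $\mathbb{P}_H(X) := |X|/|H|$ for $X\subset H$, $\widehat{f}(\gamma) := \mathbb{E}_{x\in H}f(x)\overline{\gamma(x)}$ for characters $\gamma$ of $H$, $\langle f,g\rangle_{L^2(H)} := \mathbb{E}_{x\in H}f(x)\overline{g(x)}$, $(f\ast g)(x) := \mathbb{E}_{y\in H}f(y)g(x-y)$, and $\tau_h f(x) := f(x+h)$. A family on $H$ is a vector $\mathcal{A}=(A_h)_{h\in H}$ with each $A_h\subset H$; its density function is $f_{\mathcal{A}}(h) := \mathbb{P}_H(A_h)$, its density is $\mathbb{P}_H(\mathcal{A}) := \mathbb{E}_{h\in H}f_{\mathcal{A}}(h)$, and \[ \Lambda(\mathcal{A}) := \mathbb{E}_{h\in H}\langle \tau_h(1_{A_h}\ast 1_{A_h}), f_{\mathcal{A}}\rangle_{L^2(H)}, \] equivalently $|H|^4\Lambda(\mathcal{A})$ is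 the number of quadruples $(a,a',y,h)$ with $a,a'\in A_h$ and $y\in A_{a+a'-h}$. For a subgroup $H'$, families on $H'$ and the quantities $\mathbb{P}_{H'}(\cdot)$, $\Lambda(\cdot)$ are defined in the same way with $H'$ in place of $H$. -}

module Defs where

open import Data.Bool using (Bool; true; false; if_then_else_; _xor_)
open import Data.Nat as ℕ using (ℕ; zero; suc)
open import Data.Integer using (+_)
open import Data.List using (List; []; _∷_; map; _++_; length; filter)
open import Data.Vec using (Vec; []; _∷_; zipWith; replicate)
open import Data.Rational using (ℚ; 0ℚ; 1ℚ; _+_; _*_; _/_)
open import Data.Product using (Σ; _×_; _,_)
open import Relation.Binary.PropositionalEquality using (_≡_; _≢_)
open import Relation.Nullary using (¬_)

-- The group H = 𝔽₂ⁿ (every finite abelian group of exponent 2 is of this form).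
H : ℕ → Set
H n = Vec Bool n

_⊕_ : ∀ {n} → H n → H n → H n
_⊕_ = zipWith _xor_

zeroH : ∀ {n} → H n
zeroH = replicate _ false

elems : (n : ℕ) → List (H n)
elems zero = [] ∷ []
elems (suc n) = map (false ∷_) (elems n) ++ map (true ∷_) (elems n)

-- a / b in ℚ (b = 0 gives 0; never used with b = 0 on a nonempty group)
_÷ℕ_ : ℕ → ℕ → ℚ
a ÷ℕ zero = 0ℚ
a ÷ℕ suc b = (+ a) / suc b

sumℚ : List ℚ → ℚ
sumℚ [] = 0ℚ
sumℚ (x ∷ xs) = x + sumℚ xs

𝔼 : ∀ {n} → List (H n) → (H n → ℚ) → ℚ
𝔼 G f = sumℚ (map f G) * (1 ÷ℕ length G)

𝟙 : ∀ {n} → (H n → Bool) → H n → ℚ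
𝟙 A x = if A x then 1ℚ else 0ℚ

-- A family: h ↦ A_h, with x ∈ A_h iff A h x ≡ true
Family : ℕ → Set
Family n = H n → H n → Bool

-- All quantities below are taken relative to an ambient finite group G,
-- given as the list of its elements (G = elems n for H, or the elements of a subgroup).

ℙ : ∀ {n} → List (H n) → (H n → Bool) → ℚ
ℙ G X = 𝔼 G (𝟙 X)

dens : ∀ {n} → List (H n) → Family n → H n → ℚ
dens G A h = ℙ G (A h)

ℙFam : ∀ {n} → List (H n) → Family n → ℚ
ℙFam G A = 𝔼 G (dens G A)

-- convolution (f ∗ g)(x) = 𝔼_{y} f(y) g(x - y)   (x - y = x ⊕ y in exponent 2)
conv : ∀ {n} → List (H n) → (H n → ℚ) → (H n → ℚ) → H n → ℚ
conv G f g x = 𝔼 G (λ y → f y * g (x ⊕ y))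

-- ⟨f, g⟩ = 𝔼_x f(x) g(x)  (real-valued functions, conjugation trivial)
inner : ∀ {n} → List (H n) → (H n → ℚ) → (H n → ℚ) → ℚ
inner G f g = 𝔼 G (λ x → f x * g x)

τ : ∀ {n} → H n → (H n → ℚ) → H n → ℚ
τ h f x = f (x ⊕ h)

Λ : ∀ {n} → List (H n) → Family n → ℚ
Λ G A = 𝔼 G (λ h → inner G (τ h (conv G (𝟙 (A h)) (𝟙 (A h)))) (dens G A))

-- Characters of H: homomorphisms (H, ⊕) → multiplicative group.  Since H has
-- exponent 2 every character takes values ±1, so rational values suffice.
record Character (n : ℕ) : Set where
  field
    χ     : H n → ℚ
    χ-zero : χ zeroH ≡ 1ℚ
    χ-hom : ∀ x y → χ (x ⊕ y) ≡ χ x * χ y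
open Character public

NonTrivial : ∀ {n} → Character n → Set
NonTrivial {n} γ = Σ (H n) λ x → χ γ x ≢ 1ℚ

-- Fourier coefficient  \hat f(γ) = 𝔼_x f(x) \overline{γ(x)}  (γ real-valued)
fourier : ∀ {n} → (H n → ℚ) → Character n → ℚ
fourier {n} f γ = 𝔼 (elems n) (λ x → f x * χ γ x)

IsSubgroup : ∀ {n} → (H n → Bool) → Set
IsSubgroup {n} S = (S zeroH ≡ true) × (∀ x y → S x ≡ true → S y ≡ true → S (x ⊕ y) ≡ true)

elemsOf : ∀ {n} → (H n → Bool) → List (H n)
elemsOf {n} S = filter (λ x → Data.Bool._≟_ (S x) true) (elems n)
  where import Data.Bool

Index2 : ∀ {n} → (H n → Bool) → Set
Index2 {n} S = length (elems n) ≡ 2 ℕ.* length (elemsOf S)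

-- 𝒜' is a family on the subgroup S: for h ∈ S, A'_h ⊆ S
-- (the values of A' at h ∉ S are irrelevant to all quantities over S)
FamilyOn : ∀ {n} → (H n → Bool) → Family n → Set
FamilyOn {n} S A' = ∀ (h x : H n) → S h ≡ true → A' h x ≡ true → S x ≡ true

module Submission where

-- Let S = ker γ, a subgroup of index 2, and fix x₀ with γ(x₀) = -1, so that
-- H = S ⊔ (S ⊕ x₀).  For each k put p_k = |A_k ∩ S| and q_k = |(A_k ⊕ x₀) ∩ S|.
-- Then |H|·ℙ(A_k) = p_k + q_k and |H|·\hat{1_{A_k}}(γ) = p_k - q_k, hence
-- |H|·(ℙ(A_k) + |\hat{1_{A_k}}(γ)|) ≤ 2·max(p_k, q_k).  Translating each A_k by
-- the better shift c_k ∈ {0, x₀}, and then reindexing by the better g ∈ {0, x₀},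
-- the family A'_h = S ∩ (A_{h⊕g} ⊕ c_{h⊕g}) on S has the claimed density.  For Λ,
-- the quadruples counted for 𝒜' on S translate into quadruples counted for 𝒜 on H,
-- and renormalising from |H| to |S| = |H|/2 costs exactly the factor 2⁴.

open import Defs
open import Data.Bool as Bool using (Bool; true; false; not; _∧_; if_then_else_)
open import Data.Bool.Properties using (xor-comm; xor-assoc; xor-identityʳ; xor-same; ∧-conicalˡ; ∧-conicalʳ)
open import Data.Nat as ℕ using (ℕ; zero; suc)
import Data.Nat.Properties as ℕ
import Data.Integer as ℤ
open import Data.Integer.Solver renaming (module +-*-Solver to ℤ-Solver)
open import Data.List using (List; []; _∷_; map; _++_; length; filter; foldr)
import Data.List.Properties as List
open import Data.List.Relation.Binary.Permutation.Propositional
  using (_↭_; ↭-refl; ↭-trans; ↭-reflexive; ↭⇒↭ₛ)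
import Data.List.Relation.Binary.Permutation.Propositional.Properties as Perm
import Data.List.Relation.Binary.Permutation.Setoid.Properties as Permₛ
open import Data.Vec using ([]; _∷_)
open import Data.Vec.Properties using (zipWith-comm; zipWith-assoc; zipWith-identityʳ)
open import Data.Rational as ℚ
  using (ℚ; 0ℚ; 1ℚ; _≤_; _+_; _*_; _-_; -_; _/_; ∣_∣; toℚᵘ; fromℚᵘ)
open import Data.Rational.Properties
import Data.Rational.Unnormalised as ℚᵘ
import Data.Rational.Unnormalised.Properties as ℚᵘ
open import Data.Rational.Solver using (module +-*-Solver)
open import Data.Product using (Σ; _×_; _,_; proj₁; proj₂)
open import Data.Sum using ([_,_]′)
open import Data.Empty using (⊥-elim)
open import Function using (_∘_; case_of_)
open import Relation.Nullary using (Dec; does; yes; no)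
open import Relation.Binary.PropositionalEquality

⊕-comm : ∀ {n} (x y : H n) → x ⊕ y ≡ y ⊕ x
⊕-comm = zipWith-comm xor-comm

⊕-assoc : ∀ {n} (x y z : H n) → (x ⊕ y) ⊕ z ≡ x ⊕ (y ⊕ z)
⊕-assoc = zipWith-assoc xor-assoc

⊕-identityʳ : ∀ {n} (x : H n) → x ⊕ zeroH ≡ x
⊕-identityʳ = zipWith-identityʳ xor-identityʳ

⊕-self : ∀ {n} (x : H n) → x ⊕ x ≡ zeroH
⊕-self [] = refl
⊕-self (a ∷ x) = cong₂ _∷_ (xor-same a) (⊕-self x)

⊕-involutive : ∀ {n} (x c : H n) → (x ⊕ c) ⊕ c ≡ x
⊕-involutive x c = begin
  (x ⊕ c) ⊕ c   ≡⟨ ⊕-assoc x c c ⟩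
  x ⊕ (c ⊕ c)   ≡⟨ cong (x ⊕_) (⊕-self c) ⟩
  x ⊕ zeroH     ≡⟨ ⊕-identityʳ x ⟩
  x             ∎
  where open ≡-Reasoning

⊕-cancel-shift : ∀ {n} (x h g : H n) → (x ⊕ g) ⊕ (h ⊕ g) ≡ x ⊕ h
⊕-cancel-shift x h g = begin
  (x ⊕ g) ⊕ (h ⊕ g)   ≡⟨ cong ((x ⊕ g) ⊕_) (⊕-comm h g) ⟩
  (x ⊕ g) ⊕ (g ⊕ h)   ≡⟨ ⊕-assoc x g (g ⊕ h) ⟩
  x ⊕ (g ⊕ (g ⊕ h))   ≡⟨ cong (x ⊕_) (sym (⊕-assoc g g h)) ⟩
  x ⊕ ((g ⊕ g) ⊕ h)   ≡⟨ cong (x ⊕_) (cong (_⊕ h) (⊕-self g)) ⟩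
  x ⊕ (zeroH ⊕ h)     ≡⟨ cong (x ⊕_) (trans (⊕-comm zeroH h) (⊕-identityʳ h)) ⟩
  x ⊕ h               ∎
  where open ≡-Reasoning

∑ : {A : Set} → List A → (A → ℚ) → ℚ
∑ L f = sumℚ (map f L)

-- sumℚ is the fold of the commutative monoid (ℚ, +, 0), hence permutation invariant.
sumℚ-↭ : ∀ {xs ys} → xs ↭ ys → sumℚ xs ≡ sumℚ ys
sumℚ-↭ {xs} {ys} xs↭ys = begin
  sumℚ xs             ≡⟨ sumℚ≡foldr xs ⟩
  foldr _+_ 0ℚ xs     ≡⟨ Permₛ.foldr-commMonoid (setoid ℚ) +-0-isCommutativeMonoid (↭⇒↭ₛ xs↭ys) ⟩
  foldr _+_ 0ℚ ys     ≡⟨ sym (sumℚ≡foldr ys) ⟩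
  sumℚ ys             ∎
  where
  open ≡-Reasoning
  sumℚ≡foldr : ∀ zs → sumℚ zs ≡ foldr _+_ 0ℚ zs
  sumℚ≡foldr [] = refl
  sumℚ≡foldr (z ∷ zs) = cong (z +_) (sumℚ≡foldr zs)

module _ {A : Set} where

  ∑-↭ : ∀ {L L′ : List A} f → L ↭ L′ → ∑ L f ≡ ∑ L′ f
  ∑-↭ f L↭L′ = sumℚ-↭ (Perm.map⁺ f L↭L′)

  ∑-cong : ∀ (L : List A) {f g} → (∀ x → f x ≡ g x) → ∑ L f ≡ ∑ L g
  ∑-cong [] f≗g = refl
  ∑-cong (x ∷ L) f≗g = cong₂ _+_ (f≗g x) (∑-cong L f≗g)

  ∑-+ : ∀ (L : List A) f g → ∑ L (λ x → f x + g x) ≡ ∑ L f + ∑ L g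
  ∑-+ [] f g = sym (+-identityˡ 0ℚ)
  ∑-+ (x ∷ L) f g = trans (cong (f x + g x +_) (∑-+ L f g)) (interchange (f x) (g x) _ _)
    where
    open +-*-Solver
    interchange : ∀ a b c d → (a + b) + (c + d) ≡ (a + c) + (b + d)
    interchange = solve 4 (λ a b c d → (a :+ b) :+ (c :+ d) := (a :+ c) :+ (b :+ d)) refl

  ∑-*ʳ : ∀ (L : List A) f c → ∑ L (λ x → f x * c) ≡ ∑ L f * c
  ∑-*ʳ [] f c = sym (*-zeroˡ c)
  ∑-*ʳ (x ∷ L) f c = trans (cong (f x * c +_) (∑-*ʳ L f c)) (sym (*-distribʳ-+ c (f x) _))

  ∑-mono : ∀ (L : List A) {f g} → (∀ x → f x ≤ g x) → ∑ L f ≤ ∑ L g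
  ∑-mono [] f≤g = ≤-refl
  ∑-mono (x ∷ L) f≤g = +-mono-≤ (f≤g x) (∑-mono L f≤g)

  ∑-nonneg : ∀ (L : List A) {f} → (∀ x → 0ℚ ≤ f x) → 0ℚ ≤ ∑ L f
  ∑-nonneg L {f} f≥0 = ≤-trans (≤-reflexive (sym (∑-zero L))) (∑-mono L f≥0)
    where
    ∑-zero : ∀ (L : List A) → ∑ L (λ _ → 0ℚ) ≡ 0ℚ
    ∑-zero [] = refl
    ∑-zero (x ∷ L) = trans (+-identityˡ _) (∑-zero L)

-- The sublist of L cut out by a Boolean predicate S; elemsOf S is restrict S (elems n).
restrict : {A : Set} → (A → Bool) → List A → List A
restrict S = filter (λ x → S x Bool.≟ true)

module _ {A : Set} (S : A → Bool) where

  ∑-restrict-≤ : ∀ (L : List A) {f} → (∀ x → 0ℚ ≤ f x) → ∑ (restrict S L) f ≤ ∑ L f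
  ∑-restrict-≤ [] f≥0 = ≤-refl
  ∑-restrict-≤ (x ∷ L) {f} f≥0 with S x
  ... | true = +-monoʳ-≤ (f x) (∑-restrict-≤ L f≥0)
  ... | false = ≤-trans (≤-reflexive (sym (+-identityˡ _))) (+-mono-≤ (f≥0 x) (∑-restrict-≤ L f≥0))

  ∑-restrict-cong : ∀ (L : List A) {f g} → (∀ x → S x ≡ true → f x ≡ g x) →
                    ∑ (restrict S L) f ≡ ∑ (restrict S L) g
  ∑-restrict-cong [] f≗g = refl
  ∑-restrict-cong (x ∷ L) f≗g with S x in Sx
  ... | true = cong₂ _+_ (f≗g x Sx) (∑-restrict-cong L f≗g)
  ... | false = ∑-restrict-cong L f≗g

  -- Partition along an involution σ exchanging S and its complement: each x ∉ S
  -- is σ of the element σ x ∈ S, so L splits into restrict S L and σ(restrict S (σ L)).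
  module _ (σ : A → A) (σ-involutive : ∀ x → σ (σ x) ≡ x)
           (σ-swaps : ∀ x → S (σ x) ≡ not (S x)) where

    ∑-partition : ∀ (L : List A) f →
                  ∑ L f ≡ ∑ (restrict S L) f + ∑ (restrict S (map σ L)) (f ∘ σ)
    ∑-partition [] f = sym (+-identityˡ 0ℚ)
    ∑-partition (x ∷ L) f with S x in Sx
    ... | true rewrite σ-swaps x | Sx =
      trans (cong (f x +_) (∑-partition L f)) (sym (+-assoc (f x) _ _))
    ... | false rewrite σ-swaps x | Sx | σ-involutive x =
      trans (cong (f x +_) (∑-partition L f)) (+-left-swap (f x) (∑ (restrict S L) f) _)
      where
      open +-*-Solver
      +-left-swap : ∀ a b c → a + (b + c) ≡ b + (a + c)
      +-left-swap = solve 3 (λ a b c → a :+ (b :+ c) := b :+ (a :+ c)) refl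

    length-partition : ∀ (L : List A) →
                       length L ≡ length (restrict S L) ℕ.+ length (restrict S (map σ L))
    length-partition [] = refl
    length-partition (x ∷ L) with S x in Sx
    ... | true rewrite σ-swaps x | Sx = cong suc (length-partition L)
    ... | false rewrite σ-swaps x | Sx =
      trans (cong suc (length-partition L)) (sym (ℕ.+-suc _ _))

-- Inductively, translating by (b ∷ c) translates both halves of elems (suc n)
-- by c, and exchanges them when b = true.
translate-↭ : ∀ n (c : H n) → map (_⊕ c) (elems n) ↭ elems n
translate-↭ zero [] = ↭-refl
translate-↭ (suc n) (b ∷ c) =
  ↭-trans (↭-reflexive translate-halves)
    (↭-trans (Perm.++⁺ (Perm.map⁺ (Bool._xor_ false b ∷_) (translate-↭ n c))
                       (Perm.map⁺ (Bool._xor_ true b ∷_) (translate-↭ n c)))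
             (halves b))
  where
  E : List (H n)
  E = elems n
  translate-halves : map (_⊕ (b ∷ c)) (map (false ∷_) E ++ map (true ∷_) E)
                     ≡ map (Bool._xor_ false b ∷_) (map (_⊕ c) E) ++ map (Bool._xor_ true b ∷_) (map (_⊕ c) E)
  translate-halves = trans (List.map-++ (_⊕ (b ∷ c)) (map (false ∷_) E) (map (true ∷_) E))
    (cong₂ _++_ (trans (sym (List.map-∘ E)) (List.map-∘ E)) (trans (sym (List.map-∘ E)) (List.map-∘ E)))
  halves : ∀ b → map (Bool._xor_ false b ∷_) E ++ map (Bool._xor_ true b ∷_) E ↭ map (false ∷_) E ++ map (true ∷_) E
  halves false = ↭-refl
  halves true = Perm.++-comm (map (true ∷_) E) (map (false ∷_) E)

∑-translate : ∀ n (c : H n) f → ∑ (elems n) (λ x → f (x ⊕ c)) ≡ ∑ (elems n) f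
∑-translate n c f = trans (cong sumℚ (List.map-∘ (elems n))) (∑-↭ f (translate-↭ n c))

÷ℕ-nonneg : ∀ k → 0ℚ ≤ 1 ÷ℕ k
÷ℕ-nonneg zero = ≤-refl
÷ℕ-nonneg (suc k) = nonNegative⁻¹ _ {{normalize-nonNeg 1 (suc k)}}

-- Halving a group doubles the weight: 1/k = 1/(2k) + 1/(2k) (also for k = 0,
-- where both sides are 0 by the convention of ÷ℕ).
÷ℕ-half : ∀ k → 1 ÷ℕ k ≡ 1 ÷ℕ (k ℕ.+ k) + 1 ÷ℕ (k ℕ.+ k)
÷ℕ-half zero = sym (+-identityˡ 0ℚ)
÷ℕ-half (suc m) = toℚᵘ-injective (begin
  toℚᵘ (1 ÷ℕ suc m)                ≈⟨ toℚᵘ-fromℚᵘ (ℚᵘ.mkℚᵘ (ℤ.+ 1) m) ⟩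
  ℚᵘ.mkℚᵘ (ℤ.+ 1) m                ≈⟨ ℚᵘ.*≡* (doubling (ℤ.+ suc m)) ⟩
  halfᵘ ℚᵘ.+ halfᵘ                 ≈⟨ ℚᵘ.≃-sym (ℚᵘ.+-cong (toℚᵘ-fromℚᵘ halfᵘ) (toℚᵘ-fromℚᵘ halfᵘ)) ⟩
  toℚᵘ half ℚᵘ.+ toℚᵘ half         ≈⟨ ℚᵘ.≃-sym (toℚᵘ-homo-+ half half) ⟩
  toℚᵘ (half + half)               ∎)
  where
  open ℚᵘ.≃-Reasoning
  open ℤ-Solver
  halfᵘ : ℚᵘ.ℚᵘ
  halfᵘ = ℚᵘ.mkℚᵘ (ℤ.+ 1) (m ℕ.+ suc m)
  half : ℚ
  half = fromℚᵘ halfᵘ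
  doubling : ∀ k → ℤ.+ 1 ℤ.* ((k ℤ.+ k) ℤ.* (k ℤ.+ k)) ≡ (ℤ.+ 1 ℤ.* (k ℤ.+ k) ℤ.+ ℤ.+ 1 ℤ.* (k ℤ.+ k)) ℤ.* k
  doubling = solve 1 (λ k → con (ℤ.+ 1) :* ((k :+ k) :* (k :+ k))
                        := (con (ℤ.+ 1) :* (k :+ k) :+ con (ℤ.+ 1) :* (k :+ k)) :* k) refl

*-mono-≤-nonNeg : ∀ {a b c d} → 0ℚ ≤ a → a ≤ b → 0ℚ ≤ c → c ≤ d → a * c ≤ b * d
*-mono-≤-nonNeg {a} {b} {c} {d} a≥0 a≤b c≥0 c≤d =
  ≤-trans (*-monoʳ-≤-nonNeg c {{ℚ.nonNegative c≥0}} a≤b)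
          (*-monoˡ-≤-nonNeg b {{ℚ.nonNegative (≤-trans a≥0 a≤b)}} c≤d)

*-nonneg : ∀ {a b} → 0ℚ ≤ a → 0ℚ ≤ b → 0ℚ ≤ a * b
*-nonneg a≥0 b≥0 = ≤-trans (≤-reflexive (sym (*-zeroˡ 0ℚ))) (*-mono-≤-nonNeg ≤-refl a≥0 ≤-refl b≥0)

-- (p + q) + |p - q| = 2·max(p, q): if both p and q are at most M, it is at most 2M.
sum+gap-≤ : ∀ {p q M} → p ≤ M → q ≤ M → (p + q) + ∣ p - q ∣ ≤ M + M
sum+gap-≤ {p} {q} {M} p≤M q≤M = [ gap≡p-q , gap≡q-p ]′ (∣p∣≡p∨∣p∣≡-p (p - q))
  where
  open +-*-Solver
  gap≡p-q : ∣ p - q ∣ ≡ p - q → (p + q) + ∣ p - q ∣ ≤ M + M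
  gap≡p-q eq = ≤-trans (≤-reflexive (trans (cong ((p + q) +_) eq) (two-p p q))) (+-mono-≤ p≤M p≤M)
    where
    two-p : ∀ p q → (p + q) + (p - q) ≡ p + p
    two-p = solve 2 (λ p q → (p :+ q) :+ (p :- q) := p :+ p) refl
  gap≡q-p : ∣ p - q ∣ ≡ - (p - q) → (p + q) + ∣ p - q ∣ ≤ M + M
  gap≡q-p eq = ≤-trans (≤-reflexive (trans (cong ((p + q) +_) eq) (two-q p q))) (+-mono-≤ q≤M q≤M)
    where
    two-q : ∀ p q → (p + q) + - (p - q) ≡ q + q
    two-q = solve 2 (λ p q → (p :+ q) :+ :- (p :- q) := q :+ q) refl

𝟙-nonneg : ∀ {n} (X : H n → Bool) x → 0ℚ ≤ 𝟙 X x
𝟙-nonneg X x with X x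
... | true = nonNegative⁻¹ 1ℚ
... | false = ≤-refl

𝟙-mono : ∀ {n} (X Y : H n → Bool) x y → (X x ≡ true → Y y ≡ true) → 𝟙 X x ≤ 𝟙 Y y
𝟙-mono X Y x y X⇒Y with X x
... | false = 𝟙-nonneg Y y
... | true rewrite X⇒Y refl = ≤-refl

select : {X P : Set} → Dec P → X → X → X
select (yes _) a b = a
select (no _) a b = b

better : {X : Set} → (X → ℚ) → X → X → X
better f a b = select (f b ≤? f a) a b

better-≥ : {X : Set} (f : X → ℚ) (a b : X) → (f a ≤ f (better f a b)) × (f b ≤ f (better f a b))
better-≥ f a b = from-decision (f b ≤? f a)
  where
  from-decision : (d : Dec (f b ≤ f a)) → (f a ≤ f (select d a b)) × (f b ≤ f (select d a b))
  from-decision (yes fb≤fa) = ≤-refl , fb≤fa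
  from-decision (no fb≰fa) = <⇒≤ (≰⇒> fb≰fa) , ≤-refl

module CosetSplit {n} (S : H n → Bool) (x₀ : H n)
                  (shift-swaps : ∀ x → S (x ⊕ x₀) ≡ not (S x)) where

  private
    shifted-↭ : restrict S (map (_⊕ x₀) (elems n)) ↭ elemsOf S
    shifted-↭ = Perm.filter-↭ _ (translate-↭ n x₀)

  ∑-cosets : ∀ f → ∑ (elems n) f ≡ ∑ (elemsOf S) f + ∑ (elemsOf S) (λ x → f (x ⊕ x₀))
  ∑-cosets f = trans (∑-partition S (_⊕ x₀) (λ x → ⊕-involutive x x₀) shift-swaps (elems n) f)
                     (cong (∑ (elemsOf S) f +_) (∑-↭ _ shifted-↭))

  length-cosets : length (elems n) ≡ length (elemsOf S) ℕ.+ length (elemsOf S)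
  length-cosets = trans (length-partition S (_⊕ x₀) (λ x → ⊕-involutive x x₀) shift-swaps (elems n))
                        (cong (length (elemsOf S) ℕ.+_) (Perm.↭-length shifted-↭))

  index2 : Index2 S
  index2 = trans length-cosets (cong (length (elemsOf S) ℕ.+_) (sym (ℕ.+-identityʳ _)))

  weight-doubles : 1 ÷ℕ length (elemsOf S) ≡ 1 ÷ℕ length (elems n) + 1 ÷ℕ length (elems n)
  weight-doubles = trans (÷ℕ-half (length (elemsOf S))) (cong (λ k → 1 ÷ℕ k + 1 ÷ℕ k) (sym length-cosets))

-- A rational whose square is 1 is either 1 or -1: (q - 1)(q + 1) = 0 and q - 1 is invertible.
square≡1⇒≡-1 : ∀ q → q * q ≡ 1ℚ → q ≢ 1ℚ → q ≡ - 1ℚ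
square≡1⇒≡-1 q q²≡1 q≢1 with #⇒invertible q≢1
... | i , i*[q-1]≡1 , _ = begin
  q                              ≡⟨ expand q ⟩
  1ℚ * (q + 1ℚ) - 1ℚ             ≡⟨ cong (λ z → z * (q + 1ℚ) - 1ℚ) (sym i*[q-1]≡1) ⟩
  (i * (q - 1ℚ)) * (q + 1ℚ) - 1ℚ ≡⟨ difference-of-squares i q ⟩
  i * (q * q - 1ℚ) - 1ℚ          ≡⟨ cong (λ z → i * (z - 1ℚ) - 1ℚ) q²≡1 ⟩
  i * (1ℚ - 1ℚ) - 1ℚ             ≡⟨ collapse i ⟩
  - 1ℚ                           ∎
  where
  open ≡-Reasoning
  open +-*-Solver
  expand : ∀ q → q ≡ 1ℚ * (q + 1ℚ) - 1ℚ
  expand = solve 1 (λ q → q := con 1ℚ :* (q :+ con 1ℚ) :- con 1ℚ) refl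
  difference-of-squares : ∀ i q → (i * (q - 1ℚ)) * (q + 1ℚ) - 1ℚ ≡ i * (q * q - 1ℚ) - 1ℚ
  difference-of-squares = solve 2 (λ i q → (i :* (q :- con 1ℚ)) :* (q :+ con 1ℚ) :- con 1ℚ
                                         := i :* (q :* q :- con 1ℚ) :- con 1ℚ) refl
  collapse : ∀ i → i * (1ℚ - 1ℚ) - 1ℚ ≡ - 1ℚ
  collapse = solve 1 (λ i → i :* (con 1ℚ :- con 1ℚ) :- con 1ℚ := :- con 1ℚ) refl

module Kernel {n} (γ : Character n) where

  χ-square : ∀ x → χ γ x * χ γ x ≡ 1ℚ
  χ-square x = trans (sym (χ-hom γ x x)) (trans (cong (χ γ) (⊕-self x)) (χ-zero γ))

  ker : H n → Bool
  ker x = does (χ γ x ℚ.≟ 1ℚ)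

  ker⇒χ≡1 : ∀ x → ker x ≡ true → χ γ x ≡ 1ℚ
  ker⇒χ≡1 x x∈ker with χ γ x ℚ.≟ 1ℚ
  ... | yes χx≡1 = χx≡1

  χ≡1⇒ker : ∀ x → χ γ x ≡ 1ℚ → ker x ≡ true
  χ≡1⇒ker x χx≡1 with χ γ x ℚ.≟ 1ℚ
  ... | yes _ = refl
  ... | no χx≢1 = ⊥-elim (χx≢1 χx≡1)

  χ≢1⇒¬ker : ∀ x → χ γ x ≢ 1ℚ → ker x ≡ false
  χ≢1⇒¬ker x χx≢1 with χ γ x ℚ.≟ 1ℚ
  ... | yes χx≡1 = ⊥-elim (χx≢1 χx≡1)
  ... | no _ = refl

  ker-subgroup : IsSubgroup ker
  ker-subgroup = χ≡1⇒ker zeroH (χ-zero γ) , closed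
    where
    closed : ∀ x y → ker x ≡ true → ker y ≡ true → ker (x ⊕ y) ≡ true
    closed x y x∈ker y∈ker = χ≡1⇒ker (x ⊕ y)
      (trans (χ-hom γ x y) (trans (cong₂ _*_ (ker⇒χ≡1 x x∈ker) (ker⇒χ≡1 y y∈ker)) (*-identityˡ 1ℚ)))

  -- An element x₀ outside the kernel has γ(x₀) = -1, so translating by x₀ negates γ
  -- and exchanges the kernel with its complement.
  module Outside (x₀ : H n) (χx₀≢1 : χ γ x₀ ≢ 1ℚ) where

    χ-shift : ∀ x → χ γ (x ⊕ x₀) ≡ - χ γ x
    χ-shift x = begin
      χ γ (x ⊕ x₀)         ≡⟨ χ-hom γ x x₀ ⟩
      χ γ x * χ γ x₀       ≡⟨ cong (χ γ x *_) (square≡1⇒≡-1 (χ γ x₀) (χ-square x₀) χx₀≢1) ⟩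
      χ γ x * - 1ℚ         ≡⟨ sym (neg-distribʳ-* (χ γ x) 1ℚ) ⟩
      - (χ γ x * 1ℚ)       ≡⟨ cong -_ (*-identityʳ (χ γ x)) ⟩
      - χ γ x              ∎
      where open ≡-Reasoning

    ker-shift : ∀ x → ker (x ⊕ x₀) ≡ not (ker x)
    ker-shift x with ker x in x∈?ker
    ... | true = χ≢1⇒¬ker (x ⊕ x₀) λ eq →
      -1≢1 (trans (sym (cong -_ (ker⇒χ≡1 x x∈?ker))) (trans (sym (χ-shift x)) eq))
      where
      -1≢1 : - 1ℚ ≢ 1ℚ
      -1≢1 ()
    ... | false = χ≡1⇒ker (x ⊕ x₀)
      (trans (χ-shift x) (cong -_ (square≡1⇒≡-1 (χ γ x) (χ-square x) (x∉ker⇒χ≢1 x∈?ker))))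
      where
      x∉ker⇒χ≢1 : ker x ≡ false → χ γ x ≢ 1ℚ
      x∉ker⇒χ≢1 x∉ker χx≡1 = case (trans (sym (χ≡1⇒ker x χx≡1)) x∉ker) of λ ()

    open CosetSplit ker x₀ ker-shift public

pairCount : ∀ {n} → List (H n) → Family n → H n → H n → ℚ
pairCount G A h x = ∑ G (λ y → 𝟙 (A h) y * 𝟙 (A h) ((x ⊕ h) ⊕ y))

size : ∀ {n} → List (H n) → Family n → H n → ℚ
size G A x = ∑ G (𝟙 (A x))

count : ∀ {n} → List (H n) → Family n → ℚ
count G A = ∑ G (λ h → ∑ G (λ x → pairCount G A h x * size G A x))

pairCount-nonneg : ∀ {n} (G : List (H n)) (A : Family n) h x → 0ℚ ≤ pairCount G A h x
pairCount-nonneg G A h x = ∑-nonneg G λ y → *-nonneg (𝟙-nonneg (A h) y) (𝟙-nonneg (A h) ((x ⊕ h) ⊕ y))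

size-nonneg : ∀ {n} (G : List (H n)) (A : Family n) x → 0ℚ ≤ size G A x
size-nonneg G A x = ∑-nonneg G (𝟙-nonneg (A x))

_⁴ : ℚ → ℚ
w ⁴ = ((w * w) * w) * w

Λ≡count : ∀ {n} (G : List (H n)) (A : Family n) → Λ G A ≡ count G A * (1 ÷ℕ length G) ⁴
Λ≡count {n} G A = begin
  ∑ G (λ h → ∑ G (λ x → (P h x * w) * (Z x * w)) * w) * w
    ≡⟨ cong (_* w) (∑-cong G λ h → cong (_* w) (trans (∑-cong G λ x → regroup (P h x) (Z x) w)
                                                       (∑-*ʳ G _ (w * w)))) ⟩
  ∑ G (λ h → (∑ G (λ x → P h x * Z x) * (w * w)) * w) * w
    ≡⟨ cong (_* w) (trans (∑-cong G λ h → *-assoc (∑ G (λ x → P h x * Z x)) (w * w) w)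
                          (∑-*ʳ G _ ((w * w) * w))) ⟩
  (count G A * ((w * w) * w)) * w
    ≡⟨ *-assoc (count G A) _ w ⟩
  count G A * w ⁴ ∎
  where
  open ≡-Reasoning
  open +-*-Solver
  w : ℚ
  w = 1 ÷ℕ length G
  P : H n → H n → ℚ
  P = pairCount G A
  Z : H n → ℚ
  Z = size G A
  regroup : ∀ a b w → (a * w) * (b * w) ≡ (a * b) * (w * w)
  regroup = solve 3 (λ a b w → (a :* w) :* (b :* w) := (a :* b) :* (w :* w)) refl

Λ-halving-≤ : ∀ {n} (G G′ : List (H n)) (A A′ : Family n) →
              1 ÷ℕ length G′ ≡ 1 ÷ℕ length G + 1 ÷ℕ length G →
              count G′ A′ ≤ count G A →
              ((ℤ.+ 1) / 16) * Λ G′ A′ ≤ Λ G A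
Λ-halving-≤ G G′ A A′ w′≡2w count≤ = begin
  ((ℤ.+ 1) / 16) * Λ G′ A′                  ≡⟨ cong (((ℤ.+ 1) / 16) *_) (Λ≡count G′ A′) ⟩
  ((ℤ.+ 1) / 16) * (count G′ A′ * w′ ⁴)     ≡⟨ cong (λ z → ((ℤ.+ 1) / 16) * (count G′ A′ * z ⁴)) w′≡2w ⟩
  ((ℤ.+ 1) / 16) * (count G′ A′ * (w + w) ⁴) ≡⟨ sixteenth (count G′ A′) w ⟩
  count G′ A′ * w ⁴                         ≤⟨ *-monoʳ-≤-nonNeg (w ⁴) {{ℚ.nonNegative w⁴≥0}} count≤ ⟩
  count G A * w ⁴                           ≡⟨ sym (Λ≡count G A) ⟩
  Λ G A                                     ∎
  where
  open ≤-Reasoning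
  open +-*-Solver
  w w′ : ℚ
  w = 1 ÷ℕ length G
  w′ = 1 ÷ℕ length G′
  w⁴≥0 : 0ℚ ≤ w ⁴
  w⁴≥0 = let w≥0 = ÷ℕ-nonneg (length G) in *-nonneg (*-nonneg (*-nonneg w≥0 w≥0) w≥0) w≥0
  sixteenth : ∀ c w → ((ℤ.+ 1) / 16) * (c * (w + w) ⁴) ≡ c * w ⁴
  sixteenth = solve 2 (λ c w → con ((ℤ.+ 1) / 16) :* (c :* ((((w :+ w) :* (w :+ w)) :* (w :+ w)) :* (w :+ w)))
                            := c :* (((w :* w) :* w) :* w)) refl

∑-restrict-translate-≤ : ∀ {n} (S : H n → Bool) (c : H n) {f : H n → ℚ} → (∀ x → 0ℚ ≤ f x) →
                         ∑ (elemsOf S) (λ x → f (x ⊕ c)) ≤ ∑ (elems n) f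
∑-restrict-translate-≤ {n} S c {f} f≥0 =
  ≤-trans (∑-restrict-≤ S (elems n) (λ x → f≥0 (x ⊕ c))) (≤-reflexive (∑-translate n c f))

-- Counts are monotone under shifted subfamilies: if every A′_h (h ∈ S) lies in the
-- translate A_{h⊕g} ⊕ c_{h⊕g}, then the quadruples counted for 𝒜′ on S are carried,
-- by translating each coordinate, to quadruples counted for 𝒜 on H.
module ShiftedSubfamily {n} (S : H n → Bool) (A A′ : Family n) (g : H n) (c : H n → H n)
                        (A′⊆A : ∀ h y → A′ h y ≡ true → A (h ⊕ g) (y ⊕ c (h ⊕ g)) ≡ true) where

  private
    E : List (H n)
    E = elems n
    ES : List (H n)
    ES = elemsOf S

  pairCount-≤ : ∀ h x → pairCount ES A′ h x ≤ pairCount E A (h ⊕ g) (x ⊕ g)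
  pairCount-≤ h x =
    ≤-trans (∑-mono ES λ y → *-mono-≤-nonNeg (𝟙-nonneg (A′ h) y) (𝟙-mono (A′ h) (A k) y (y ⊕ c k) (A′⊆A h y))
                                             (𝟙-nonneg (A′ h) ((x ⊕ h) ⊕ y)) (second y))
            (∑-restrict-translate-≤ S (c k) λ y → *-nonneg (𝟙-nonneg (A k) y) (𝟙-nonneg (A k) (((x ⊕ g) ⊕ k) ⊕ y)))
    where
    k : H n
    k = h ⊕ g
    -- the second point x ⊕ h ⊕ y is translated by c k as well
    regroup : ∀ y → ((x ⊕ h) ⊕ y) ⊕ c k ≡ ((x ⊕ g) ⊕ k) ⊕ (y ⊕ c k)
    regroup y = trans (⊕-assoc (x ⊕ h) y (c k)) (cong (_⊕ (y ⊕ c k)) (sym (⊕-cancel-shift x h g)))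
    second : ∀ y → 𝟙 (A′ h) ((x ⊕ h) ⊕ y) ≤ 𝟙 (A k) (((x ⊕ g) ⊕ k) ⊕ (y ⊕ c k))
    second y = 𝟙-mono (A′ h) (A k) _ _ λ z∈A′ → subst (λ z → A k z ≡ true) (regroup y) (A′⊆A h _ z∈A′)

  size-≤ : ∀ x → size ES A′ x ≤ size E A (x ⊕ g)
  size-≤ x = ≤-trans (∑-mono ES λ y → 𝟙-mono (A′ x) (A (x ⊕ g)) y (y ⊕ c (x ⊕ g)) (A′⊆A x y))
                     (∑-restrict-translate-≤ S (c (x ⊕ g)) (𝟙-nonneg (A (x ⊕ g))))

  count-≤ : count ES A′ ≤ count E A
  count-≤ = begin
    ∑ ES (λ h → ∑ ES (λ x → pairCount ES A′ h x * size ES A′ x))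
      ≤⟨ ∑-mono ES (λ h → ∑-mono ES λ x → *-mono-≤-nonNeg (pairCount-nonneg ES A′ h x) (pairCount-≤ h x)
                                                          (size-nonneg ES A′ x) (size-≤ x)) ⟩
    ∑ ES (λ h → ∑ ES (λ x → term (h ⊕ g) (x ⊕ g)))
      ≤⟨ ∑-mono ES (λ h → ∑-restrict-translate-≤ S g (term≥0 (h ⊕ g))) ⟩
    ∑ ES (λ h → ∑ E (term (h ⊕ g)))
      ≤⟨ ∑-restrict-translate-≤ S g (λ h → ∑-nonneg E (term≥0 h)) ⟩
    ∑ E (λ h → ∑ E (term h)) ∎
    where
    open ≤-Reasoning
    term : H n → H n → ℚ
    term h x = pairCount E A h x * size E A x
    term≥0 : ∀ h x → 0ℚ ≤ term h x
    term≥0 h x = *-nonneg (pairCount-nonneg E A h x) (size-nonneg E A x)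

module DensityIncrement {n} (A : Family n) (γ : Character n) (x₀ : H n) (χx₀≢1 : χ γ x₀ ≢ 1ℚ) where

  open Kernel γ public
  open Outside x₀ χx₀≢1 public

  E : List (H n)
  E = elems n
  ES : List (H n)
  ES = elemsOf ker
  u : ℚ
  u = 1 ÷ℕ length E
  v : ℚ
  v = 1 ÷ℕ length ES

  massOn : H n → H n → ℚ
  massOn k c = ∑ ES (λ y → 𝟙 (A k) (y ⊕ c))

  shift : H n → H n
  shift k = better (massOn k) zeroH x₀

  peak : H n → ℚ
  peak k = massOn k (shift k)

  massOn-zero : ∀ k → massOn k zeroH ≡ ∑ ES (𝟙 (A k))
  massOn-zero k = ∑-cong ES λ y → cong (𝟙 (A k)) (⊕-identityʳ y)

  size≡ : ∀ k → ∑ E (𝟙 (A k)) ≡ massOn k zeroH + massOn k x₀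
  size≡ k = trans (∑-cosets (𝟙 (A k))) (cong (_+ massOn k x₀) (sym (massOn-zero k)))

  -- |H|·\hat{1_{A_k}}(γ) = p_k - q_k, since γ is 1 on S and -1 on S ⊕ x₀
  fourier≡ : ∀ k → ∑ E (λ x → 𝟙 (A k) x * χ γ x) ≡ massOn k zeroH - massOn k x₀
  fourier≡ k = trans (∑-cosets _) (cong₂ _+_ on-S on-S⊕x₀)
    where
    open ≡-Reasoning
    on-S : ∑ ES (λ x → 𝟙 (A k) x * χ γ x) ≡ massOn k zeroH
    on-S = trans (∑-restrict-cong ker E λ x x∈S → trans (cong (𝟙 (A k) x *_) (ker⇒χ≡1 x x∈S)) (*-identityʳ _))
                 (sym (massOn-zero k))
    on-S⊕x₀ : ∑ ES (λ x → 𝟙 (A k) (x ⊕ x₀) * χ γ (x ⊕ x₀)) ≡ - massOn k x₀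
    on-S⊕x₀ = begin
      ∑ ES (λ x → 𝟙 (A k) (x ⊕ x₀) * χ γ (x ⊕ x₀))
        ≡⟨ ∑-restrict-cong ker E (λ x x∈S → cong (𝟙 (A k) (x ⊕ x₀) *_) (trans (χ-shift x) (cong -_ (ker⇒χ≡1 x x∈S)))) ⟩
      ∑ ES (λ x → 𝟙 (A k) (x ⊕ x₀) * - 1ℚ)   ≡⟨ ∑-*ʳ ES _ (- 1ℚ) ⟩
      massOn k x₀ * - 1ℚ                      ≡⟨ sym (neg-distribʳ-* (massOn k x₀) 1ℚ) ⟩
      - (massOn k x₀ * 1ℚ)                    ≡⟨ cong -_ (*-identityʳ (massOn k x₀)) ⟩
      - massOn k x₀                           ∎

  -- |H|·(ℙ(A_k) + |\hat{1_{A_k}}(γ)|) = 2 max(p_k, q_k) ≤ 2·peak k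
  local-gain : ∀ k → ∑ E (𝟙 (A k)) + ∣ ∑ E (λ x → 𝟙 (A k) x * χ γ x) ∣ ≤ peak k + peak k
  local-gain k = begin
    ∑ E (𝟙 (A k)) + ∣ ∑ E (λ x → 𝟙 (A k) x * χ γ x) ∣
      ≡⟨ cong₂ (λ a b → a + ∣ b ∣) (size≡ k) (fourier≡ k) ⟩
    (massOn k zeroH + massOn k x₀) + ∣ massOn k zeroH - massOn k x₀ ∣
      ≤⟨ sum+gap-≤ (proj₁ (better-≥ (massOn k) zeroH x₀)) (proj₂ (better-≥ (massOn k) zeroH x₀)) ⟩
    peak k + peak k ∎
    where open ≤-Reasoning

  indexMass : H n → ℚ
  indexMass g = ∑ ES (λ h → peak (h ⊕ g))

  g : H n
  g = better indexMass zeroH x₀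

  peaks-≤ : ∑ E peak ≤ indexMass g + indexMass g
  peaks-≤ = begin
    ∑ E peak                              ≡⟨ ∑-cosets peak ⟩
    ∑ ES peak + indexMass x₀              ≡⟨ cong (_+ indexMass x₀) (∑-cong ES λ h → cong peak (sym (⊕-identityʳ h))) ⟩
    indexMass zeroH + indexMass x₀        ≤⟨ +-mono-≤ (proj₁ g-better) (proj₂ g-better) ⟩
    indexMass g + indexMass g             ∎
    where
    open ≤-Reasoning
    g-better : (indexMass zeroH ≤ indexMass g) × (indexMass x₀ ≤ indexMass g)
    g-better = better-≥ indexMass zeroH x₀

  A′ : Family n
  A′ h y = ker y ∧ A (h ⊕ g) (y ⊕ shift (h ⊕ g))

  A′-on-S : FamilyOn ker A′
  A′-on-S h y _ y∈A′h = ∧-conicalˡ (ker y) _ y∈A′h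

  A′⊆A : ∀ h y → A′ h y ≡ true → A (h ⊕ g) (y ⊕ shift (h ⊕ g)) ≡ true
  A′⊆A h y y∈A′h = ∧-conicalʳ (ker y) _ y∈A′h

  size-A′ : ∀ h → ∑ ES (𝟙 (A′ h)) ≡ peak (h ⊕ g)
  size-A′ h = ∑-restrict-cong ker E λ y y∈S →
    cong (λ b → if b ∧ A (h ⊕ g) (y ⊕ shift (h ⊕ g)) then 1ℚ else 0ℚ) y∈S

  gain≡ : ℙFam E A + 𝔼 E (λ h → ∣ fourier (𝟙 (A h)) γ ∣)
          ≡ ∑ E (λ h → ∑ E (𝟙 (A h)) + ∣ ∑ E (λ x → 𝟙 (A h) x * χ γ x) ∣) * (u * u)
  gain≡ = begin
    ∑ E (λ h → P h * u) * u + ∑ E (λ h → ∣ F h * u ∣) * u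
      ≡⟨ sym (*-distribʳ-+ u (∑ E (λ h → P h * u)) (∑ E (λ h → ∣ F h * u ∣))) ⟩
    (∑ E (λ h → P h * u) + ∑ E (λ h → ∣ F h * u ∣)) * u
      ≡⟨ cong (_* u) (sym (∑-+ E _ _)) ⟩
    ∑ E (λ h → P h * u + ∣ F h * u ∣) * u
      ≡⟨ cong (_* u) (∑-cong E λ h → trans (cong (P h * u +_) (∣F*u∣ h)) (sym (*-distribʳ-+ u (P h) ∣ F h ∣))) ⟩
    ∑ E (λ h → (P h + ∣ F h ∣) * u) * u
      ≡⟨ cong (_* u) (∑-*ʳ E _ u) ⟩
    (∑ E (λ h → P h + ∣ F h ∣) * u) * u
      ≡⟨ *-assoc (∑ E (λ h → P h + ∣ F h ∣)) u u ⟩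
    ∑ E (λ h → P h + ∣ F h ∣) * (u * u) ∎
    where
    open ≡-Reasoning
    P F : H n → ℚ
    P h = ∑ E (𝟙 (A h))
    F h = ∑ E (λ x → 𝟙 (A h) x * χ γ x)
    ∣F*u∣ : ∀ h → ∣ F h * u ∣ ≡ ∣ F h ∣ * u
    ∣F*u∣ h = trans (∣p*q∣≡∣p∣*∣q∣ (F h) u) (cong (∣ F h ∣ *_) (0≤p⇒∣p∣≡p (÷ℕ-nonneg (length E))))

  density : ℙFam E A + 𝔼 E (λ h → ∣ fourier (𝟙 (A h)) γ ∣) ≤ ℙFam ES A′
  density = begin
    ℙFam E A + 𝔼 E (λ h → ∣ fourier (𝟙 (A h)) γ ∣)
      ≡⟨ gain≡ ⟩
    ∑ E (λ h → ∑ E (𝟙 (A h)) + ∣ ∑ E (λ x → 𝟙 (A h) x * χ γ x) ∣) * (u * u)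
      ≤⟨ *-monoʳ-≤-nonNeg (u * u) {{ℚ.nonNegative u²≥0}} (∑-mono E local-gain) ⟩
    ∑ E (λ h → peak h + peak h) * (u * u)
      ≡⟨ cong (_* (u * u)) (∑-+ E peak peak) ⟩
    (∑ E peak + ∑ E peak) * (u * u)
      ≤⟨ *-monoʳ-≤-nonNeg (u * u) {{ℚ.nonNegative u²≥0}} (+-mono-≤ peaks-≤ peaks-≤) ⟩
    ((indexMass g + indexMass g) + (indexMass g + indexMass g)) * (u * u)
      ≡⟨ rescale (indexMass g) u ⟩
    (indexMass g * (u + u)) * (u + u)
      ≡⟨ cong (λ w → (indexMass g * w) * w) (sym weight-doubles) ⟩
    (indexMass g * v) * v
      ≡⟨ cong (_* v) (sym (trans (∑-cong ES λ h → cong (_* v) (size-A′ h)) (∑-*ʳ ES _ v))) ⟩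
    ℙFam ES A′ ∎
    where
    open ≤-Reasoning
    open +-*-Solver
    u²≥0 : 0ℚ ≤ u * u
    u²≥0 = *-nonneg (÷ℕ-nonneg (length E)) (÷ℕ-nonneg (length E))
    rescale : ∀ m u → ((m + m) + (m + m)) * (u * u) ≡ (m * (u + u)) * (u + u)
    rescale = solve 2 (λ m u → ((m :+ m) :+ (m :+ m)) :* (u :* u) := (m :* (u :+ u)) :* (u :+ u)) refl

lemma6p2 : (n : ℕ) (A : Family n) (γ : Character n) → NonTrivial γ →
    Σ (H n → Bool) λ S → IsSubgroup S × Index2 S ×
      Σ (Family n) λ A' → FamilyOn S A' ×
        (((ℤ.+ 1) / 16) * Λ (elemsOf S) A' ≤ Λ (elems n) A) ×
        (ℙFam (elems n) A + 𝔼 (elems n) (λ h → ∣ fourier (𝟙 (A h)) γ ∣) ≤ ℙFam (elemsOf S) A')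
lemma6p2 n A γ (x₀ , χx₀≢1) = ker , ker-subgroup , index2 , A′ , A′-on-S , Λ-bound , density
  where
  open DensityIncrement A γ x₀ χx₀≢1
  -- the quadruples for 𝒜′ on S embed into those for 𝒜 on H; renormalising costs 2⁴
  Λ-bound : ((ℤ.+ 1) / 16) * Λ ES A′ ≤ Λ E A
  Λ-bound = Λ-halving-≤ E ES A A′ weight-doubles (ShiftedSubfamily.count-≤ ker A A′ g shift A′⊆A)
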